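{- If $A$ is a finite abelian group such that $d(A)\ge 3$, where $d(A)$ is the minimum size of a generating set of $A$, then $\text{GEN}(\operatorname{Dih}(A))=*0$.
   Context: For a finite abelian group $A$, $\operatorname{Dih}(A)$ is the semidirect product $C_2\ltimes A$, where $C_2=\{1,x\}$ and $x$ acts on $A$ by inversion. For a finite group $G$, the game $\text{GEN}(G)$ is the impartial game whose positions are the subsets $P\subseteq G$ that either do not generate $G$ (nonterminal) or generate $G$ and contain some $g$ with $\langle P\setminus\{g\}\rangle\neq G$ (terminal). The start is $\emptyset$; the options of a nonterminal $P$ are $P\cup\{g\}$, $g\in G\setminus P$; terminal positions have no options. $\operatorname{nim}(P)=\operatorname{mex}\{\operatorname{nim}(Q): Q\text{ an option of }P\}$, and $\text{GEN}(G)=*n$ means $\operatorname{nim}(\emptyset)=n$. -}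

module Defs where

open import Level using (0ℓ)
open import Data.Bool using (Bool; true; false; _xor_)
open import Data.Bool.Properties using (xor-assoc; xor-identityʳ)
open import Data.Nat using (ℕ; _<_; _≤_)
open import Data.Product using (_×_; _,_; Σ; ∃; proj₁; proj₂)
open import Data.List using (List; []; _∷_; length)
import Data.List.Membership.Setoid as SetoidMembership
open import Relation.Nullary using (¬_)
open import Relation.Binary using (Decidable)
open import Relation.Binary.PropositionalEquality as P using (_≡_)
open import Algebra.Bundles using (Group; AbelianGroup)
open import Algebra.Structures using (IsGroup)
import Algebra.Properties.AbelianGroup as AGProps
import Algebra.Properties.Group as GProps

module GroupNotions (G : Group 0ℓ 0ℓ) where
  open Group G
  open SetoidMembership setoid using (_∈_; _∉_)

  data ⟨_⟩ (L : List Carrier) : Carrier → Set where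
    gen  : ∀ {g} → g ∈ L → ⟨ L ⟩ g
    unit : ⟨ L ⟩ ε
    mul  : ∀ {g h} → ⟨ L ⟩ g → ⟨ L ⟩ h → ⟨ L ⟩ (g ∙ h)
    inv  : ∀ {g} → ⟨ L ⟩ g → ⟨ L ⟩ (g ⁻¹)
    resp : ∀ {g h} → g ≈ h → ⟨ L ⟩ g → ⟨ L ⟩ h

  Generates : List Carrier → Set
  Generates L = ∀ g → ⟨ L ⟩ g

  -- Positions are finite subsets of G,
  -- represented as duplicate-free lists (the starting position is []).
  -- A generating position has no options (it is terminal), so its nim
  -- value is mex ∅ = 0.  A non-generating position P has options
  -- g ∷ P for g ∉ P, and its nim value is the mex of their nim values:
  -- n is the nim value iff no option has value n and every k < n is
  -- the value of some option.
  data NimValue (P : List Carrier) : ℕ → Set where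
    terminal    : Generates P → NimValue P 0
    nonterminal : ∀ {n} → ¬ Generates P
                → (∀ g → g ∉ P → ∃ λ m → NimValue (g ∷ P) m × ¬ (m ≡ n))
                → (∀ k → k < n → ∃ λ g → g ∉ P × NimValue (g ∷ P) k)
                → NimValue P n

  GEN≡* : ℕ → Set
  GEN≡* n = NimValue [] n

module _ (A : AbelianGroup 0ℓ 0ℓ) where
  open AbelianGroup A
  open SetoidMembership setoid using (_∈_)

  record IsFinite : Set where
    field
      elements : List Carrier
      complete : ∀ a → a ∈ elements
      _≟_      : Decidable _≈_

  d≥ : ℕ → Set
  d≥ k = ∀ (L : List Carrier) → length L < k → ¬ GroupNotions.Generates group L

-- The generalized dihedral group Dih(A) = C₂ ⋉ A, x acting by inversion.
-- Elements x^s a are pairs (s , a) with s : Bool;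
-- (x^s a)(x^t b) = x^(s xor t) (a^((-1)^t) b).

module _ (A : AbelianGroup 0ℓ 0ℓ) where
  private
    module A = AbelianGroup A
    module AP = AGProps A
    module GP = GProps A.group
  open A using (Carrier; _≈_; _∙_; ε; _⁻¹)

  act : Bool → Carrier → Carrier
  act false a = a
  act true  a = a ⁻¹

  DCarrier : Set
  DCarrier = Bool × Carrier

  _≈D_ : DCarrier → DCarrier → Set
  (s , a) ≈D (t , b) = s ≡ t × a ≈ b

  _∙D_ : DCarrier → DCarrier → DCarrier
  (s , a) ∙D (t , b) = (s xor t , act t a ∙ b)

  εD : DCarrier
  εD = (false , ε)

  invD : DCarrier → DCarrier
  invD (false , a) = (false , a ⁻¹)
  invD (true  , a) = (true  , a)

  private
    act-cong : ∀ t {a b} → a ≈ b → act t a ≈ act t b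
    act-cong false p = p
    act-cong true  p = A.⁻¹-cong p

    act-hom : ∀ t a b → act t (a ∙ b) ≈ act t a ∙ act t b
    act-hom false a b = A.refl
    act-hom true  a b = A.sym (AP.⁻¹-∙-comm a b)

    act-comp : ∀ t u a → act u (act t a) ≈ act (t xor u) a
    act-comp false u     a = A.refl
    act-comp true  false a = A.refl
    act-comp true  true  a = GP.⁻¹-involutive a

    act-ε : ∀ t → act t ε ≈ ε
    act-ε false = A.refl
    act-ε true  = GP.ε⁻¹≈ε

    isGroupD : IsGroup _≈D_ _∙D_ εD invD
    isGroupD = record
      { isMonoid = record
        { isSemigroup = record
          { isMagma = record
            { isEquivalence = record
              { refl  = P.refl , A.refl
              ; sym   = λ { (p , q) → P.sym p , A.sym q }
              ; trans = λ { (p , q) (p' , q') → P.trans p p' , A.trans q q' }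
              }
            ; ∙-cong = λ { {s , a} {s' , a'} {t , b} {t' , b'} (P.refl , q) (P.refl , q') →
                         P.refl , A.∙-cong (act-cong t q) q' }
            }
          ; assoc = λ { (s , a) (t , b) (u , c) →
                      xor-assoc s t u ,
                      A.trans (A.∙-congʳ (A.trans (act-hom u (act t a) b)
                                                  (A.∙-congʳ (act-comp t u a))))
                              (A.assoc (act (t xor u) a) (act u b) c) }
          }
        ; identity = (λ { (t , b) → P.refl , A.trans (A.∙-congʳ (act-ε t)) (A.identityˡ b) })
                   , (λ { (s , a) → xor-identityʳ s , A.identityʳ a })
        }
      ; inverse = (λ { (false , a) → P.refl , A.inverseˡ a
                     ; (true , a) → P.refl , A.inverseˡ a })
                , (λ { (false , a) → P.refl , A.inverseʳ a
                     ; (true , a) → P.refl , A.inverseˡ a })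
      ; ⁻¹-cong = λ { {false , a} {.false , b} (P.refl , q) → P.refl , A.⁻¹-cong q
                    ; {true , a} {.true , b} (P.refl , q) → P.refl , q }
      }

  Dih : Group 0ℓ 0ℓ
  Dih = record { isGroup = isGroupD }

-- The second player wins by mirroring. Let x = (true , ε), a reflection, and mirror g = x g.
-- Call a position balanced if it is nonempty, closed under mirror, and no single move from it
-- generates Dih(A); it then contains some p and mirror p, so x ∈ ⟨ P ⟩. Answer a move g from a
-- balanced P by a generating move if there is one, and by mirror g otherwise: as mirror g ∈ ⟨ x , g ⟩,
-- the position mirror g, g, P is again balanced. Hence every move from a balanced position has an
-- answer of value 0, so balanced positions have value 0. The first exchange g, mirror g already
-- reaches a balanced position: the A-coordinates of g, mirror g and any h lie in a subgroup of A
-- generated by two elements, which is proper since d(A) ≥ 3.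
module Submission where

open import Defs
open import Level using (0ℓ)
open import Algebra.Bundles using (AbelianGroup; Group)
import Algebra.Properties.Group as GroupProperties
open import Data.Bool using (Bool; true; false; T; not; if_then_else_)
import Data.Bool.Properties as Bool
open import Data.Empty using (⊥-elim)
open import Data.Nat as ℕ using (ℕ; zero; suc; _+_; _<_; _≤_; z≤n; s≤s)
open import Data.Nat.GeneralisedArithmetic using (iterate)
open import Data.Nat.Induction using (<-wellFounded)
open import Data.Nat.Properties
  using (<-trans; ≤-trans; ≤-reflexive; <-≤-trans; m≤n⇒m≤1+n; m≤n⇒m<n∨m≡n; m≤n+m; +-identityʳ; +-suc;
         +-monoˡ-≤; <⇒≱; <-cmp; 1+n≰n)
open import Data.List using (List; []; _∷_; length; map; _++_)
open import Data.List.Extrema.Nat using (max; xs≤max)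
open import Data.List.Membership.Propositional using () renaming (_∈_ to _∈ₚ_; _∉_ to _∉ₚ_)
open import Data.List.Membership.DecPropositional ℕ._≟_ using () renaming (_∈?_ to _∈ℕ?_)
import Data.List.Membership.Setoid as SetoidMembership
import Data.List.Membership.Setoid.Properties as SetoidMembershipProperties
import Data.List.Relation.Binary.Subset.Setoid as SetoidSubset
import Data.List.Relation.Binary.Subset.Setoid.Properties as SetoidSubsetProperties
open import Data.List.Relation.Unary.All as All using (All; []; _∷_)
open import Data.List.Relation.Unary.Any as Any using (Any; here; there)
open import Data.Product using (_×_; _,_; ∃; proj₁; proj₂)
open import Data.Product.Relation.Binary.Pointwise.NonDependent using (×-decidable)
open import Data.Sum as Sum using (_⊎_; inj₁; inj₂)
open import Function using (_∘_)
open import Induction.WellFounded using (Acc; acc)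
open import Relation.Binary using (Decidable; tri<; tri≈; tri>)
open import Relation.Binary.Definitions using (_Respects_)
open import Relation.Binary.PropositionalEquality as ≡ using (_≡_)
open import Relation.Nullary using (¬_; Dec; yes; no)
open import Relation.Nullary.Decidable using (⌊_⌋; T?; ¬?; _⊎-dec_; map′; toWitness; fromWitness)

iterate-preserves : ∀ {A : Set} {P : A → Set} {f : A → A}
                  → (∀ {x} → P x → P (f x)) → ∀ {x} n → P x → P (iterate f x n)
iterate-preserves f-pres zero    px = px
iterate-preserves {P = P} {f} f-pres (suc n) px = iterate-preserves {P = P} {f} f-pres n (f-pres px)

module _ {A : Set} where

  count : (A → Bool) → List A → ℕ
  count q []       = 0
  count q (x ∷ xs) = if q x then suc (count q xs) else count q xs

  count≤length : ∀ q xs → count q xs ≤ length xs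
  count≤length q []       = z≤n
  count≤length q (x ∷ xs) with q x
  ... | true  = s≤s (count≤length q xs)
  ... | false = m≤n⇒m≤1+n (count≤length q xs)

  module _ {p q : A → Bool} (p⇒q : ∀ {x} → T (p x) → T (q x)) where

    count-mono : ∀ xs → count p xs ≤ count q xs
    count-mono []       = z≤n
    count-mono (x ∷ xs) with p x | q x | p⇒q {x}
    ... | true  | true  | _  = s≤s (count-mono xs)
    ... | true  | false | pq = ⊥-elim (pq _)
    ... | false | true  | _  = m≤n⇒m≤1+n (count-mono xs)
    ... | false | false | _  = count-mono xs

    count-mono-< : ∀ {xs} → Any (λ x → T (q x) × ¬ T (p x)) xs → count p xs < count q xs
    count-mono-< {x ∷ xs} (here (qx , ¬px)) with p x | q x
    ... | true  | _    = ⊥-elim (¬px _)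
    ... | false | true = s≤s (count-mono xs)
    count-mono-< {x ∷ xs} (there any) with p x | q x | p⇒q {x}
    ... | true  | true  | _  = s≤s (count-mono-< any)
    ... | true  | false | pq = ⊥-elim (pq _)
    ... | false | true  | _  = m≤n⇒m≤1+n (count-mono-< any)
    ... | false | false | _  = count-mono-< any

module _ {A : Set} (E : List A) (f : (A → Bool) → A → Bool)
         (f-inflationary : ∀ q {x} → T (q x) → T (f q x)) where

  Stable : (A → Bool) → Set
  Stable q = All (λ x → T (f q x) → T (q x)) E

  private
    stable⊎grows : ∀ q xs → All (λ x → T (f q x) → T (q x)) xs
                           ⊎ Any (λ x → T (f q x) × ¬ T (q x)) xs
    stable⊎grows q []       = inj₁ []
    stable⊎grows q (x ∷ xs) with stable⊎grows q xs | T? (q x) | T? (f q x)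
    ... | inj₂ grows  | _      | _       = inj₂ (there grows)
    ... | inj₁ stable | yes qx | _       = inj₁ ((λ _ → qx) ∷ stable)
    ... | inj₁ stable | no ¬qx | yes fqx = inj₂ (here (fqx , ¬qx))
    ... | inj₁ stable | no _   | no ¬fqx = inj₁ ((λ fqx → ⊥-elim (¬fqx fqx)) ∷ stable)

    -- each unstable step marks a new element of E, which can happen at most length E times
    stabilise : ∀ n q → length E < count q E + n → ∃ λ j → Stable (iterate f q j)
    stabilise n q bound with stable⊎grows q E
    ... | inj₁ stable = 0 , stable
    stabilise zero q bound | inj₂ _ =
      ⊥-elim (<⇒≱ bound (≤-trans (≤-reflexive (+-identityʳ (count q E))) (count≤length q E)))
    stabilise (suc n) q bound | inj₂ grows with stabilise n (f q) bound′
      where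
      bound′ : length E < count (f q) E + n
      bound′ = <-≤-trans bound (≤-trans (≤-reflexive (+-suc (count q E) n))
                                        (+-monoˡ-≤ n (count-mono-< (f-inflationary q) grows)))
    ... | j , stable = suc j , stable

  iterate-stabilises : ∀ q → ∃ λ j → Stable (iterate f q j)
  iterate-stabilises q = stabilise (suc (length E)) q (m≤n+m (suc (length E)) (count q E))

Mex : List ℕ → ℕ → Set
Mex V n = n ∉ₚ V × (∀ {k} → k < n → k ∈ₚ V)

below⊆⊎mex : ∀ V b → (∀ {k} → k < b → k ∈ₚ V) ⊎ ∃ (Mex V)
below⊆⊎mex V zero = inj₁ (λ ())
below⊆⊎mex V (suc b) with below⊆⊎mex V b | b ∈ℕ? V
... | inj₂ found | _       = inj₂ found
... | inj₁ below | no b∉V  = inj₂ (b , b∉V , below)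
... | inj₁ below | yes b∈V = inj₁ below′
  where
  below′ : ∀ {k} → k < suc b → k ∈ₚ V
  below′ (s≤s k≤b) with m≤n⇒m<n∨m≡n k≤b
  ... | inj₁ k<b    = below k<b
  ... | inj₂ ≡.refl = b∈V

mex : ∀ V → ∃ (Mex V)
mex V with below⊆⊎mex V (suc (max 0 V))
... | inj₂ found = found
... | inj₁ below = suc (max 0 V) , (λ m∈V → 1+n≰n (All.lookup (xs≤max 0 V) m∈V)) , below

module FiniteGroup (G : Group 0ℓ 0ℓ) (E : List (Group.Carrier G))
                   (E-complete : ∀ g → SetoidMembership._∈_ (Group.setoid G) g E)
                   (_≟_ : Decidable (Group._≈_ G)) where
  open Group G
  open GroupProperties G using (//-rightDividesˡ; //-rightDividesʳ; ε⁻¹≈ε; ⁻¹-involutive; ⁻¹-anti-homo-∙)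
  open GroupNotions G
  open SetoidMembership setoid using (_∈_; _∉_; find; lose)
  open SetoidSubset setoid using (_⊆_)
  open SetoidMembershipProperties using (∈-resp-≈)
  open SetoidSubsetProperties using (∷⁺ʳ; ∈-∷⁺ʳ)

  ⟨⟩-mono : ∀ {L L′} → (∀ {y} → y ∈ L → ⟨ L′ ⟩ y) → ∀ {g} → ⟨ L ⟩ g → ⟨ L′ ⟩ g
  ⟨⟩-mono L≤L′ (gen y∈L) = L≤L′ y∈L
  ⟨⟩-mono L≤L′ unit      = unit
  ⟨⟩-mono L≤L′ (mul a b) = mul (⟨⟩-mono L≤L′ a) (⟨⟩-mono L≤L′ b)
  ⟨⟩-mono L≤L′ (inv a)   = inv (⟨⟩-mono L≤L′ a)
  ⟨⟩-mono L≤L′ (resp e a) = resp e (⟨⟩-mono L≤L′ a)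

  Generates-mono : ∀ {L L′} → (∀ {y} → y ∈ L → ⟨ L′ ⟩ y) → Generates L → Generates L′
  Generates-mono L≤L′ genL g = ⟨⟩-mono L≤L′ (genL g)

  Generates-⊆ : ∀ {L L′} → L ⊆ L′ → Generates L → Generates L′
  Generates-⊆ L⊆L′ = Generates-mono (λ y∈L → gen (L⊆L′ y∈L))

  -- ⟨ L ⟩ is decided as the set of vertices reachable from ε in the Cayley graph of L,
  -- computed as the stable stage of a breadth-first search.
  module Reachability (L : List Carrier) where

    Extends : (Carrier → Bool) → Carrier → Set
    Extends q e = T (q e) ⊎ Any (λ p → T (q (e // p)) ⊎ T (q (e ∙ p))) L

    extends? : ∀ q e → Dec (Extends q e)
    extends? q e = T? (q e) ⊎-dec Any.any? (λ p → T? (q (e // p)) ⊎-dec T? (q (e ∙ p))) L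

    extend : (Carrier → Bool) → Carrier → Bool
    extend q e = ⌊ extends? q e ⌋

    extend-inflationary : ∀ q {e} → T (q e) → T (extend q e)
    extend-inflationary q {e} qe = fromWitness {a? = extends? q e} (inj₁ qe)

    extend-resp : ∀ {q} → (T ∘ q) Respects _≈_ → (T ∘ extend q) Respects _≈_
    extend-resp {q} q-resp {a} {b} a≈b ext =
      fromWitness {a? = extends? q b} (Sum.map (q-resp a≈b)
                           (Any.map (Sum.map (q-resp (∙-congʳ a≈b)) (q-resp (∙-congʳ a≈b))))
                           (toWitness {a? = extends? q a} ext))

    extend-sound : ∀ {q} → (∀ {e} → T (q e) → ⟨ L ⟩ e) → ∀ {e} → T (extend q e) → ⟨ L ⟩ e
    extend-sound {q} sound {e} ext with toWitness {a? = extends? q e} ext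
    ... | inj₁ qe = sound qe
    ... | inj₂ step with find step
    ...   | p , p∈L , inj₁ q[e//p] = resp (//-rightDividesˡ p e) (mul (sound q[e//p]) (gen p∈L))
    ...   | p , p∈L , inj₂ q[e∙p]  = resp (//-rightDividesʳ p e) (mul (sound q[e∙p]) (inv (gen p∈L)))

    isε : Carrier → Bool
    isε e = ⌊ e ≟ ε ⌋

    stage : ℕ → Carrier → Bool
    stage = iterate extend isε

    stage-resp : ∀ k → (T ∘ stage k) Respects _≈_
    stage-resp k = iterate-preserves {P = λ q → (T ∘ q) Respects _≈_} extend-resp k isε-resp
      where
      isε-resp : (T ∘ isε) Respects _≈_
      isε-resp {a} {b} a≈b a≈ε = fromWitness {a? = b ≟ ε} (trans (sym a≈b) (toWitness {a? = a ≟ ε} a≈ε))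

    stage-sound : ∀ k {e} → T (stage k e) → ⟨ L ⟩ e
    stage-sound k = iterate-preserves {P = λ q → ∀ {e} → T (q e) → ⟨ L ⟩ e} {extend} extend-sound {isε} k
                                      (λ {e} e≈ε → resp (sym (toWitness {a? = e ≟ ε} e≈ε)) unit)

    stage-ε : ∀ k → T (stage k ε)
    stage-ε k = iterate-preserves {P = λ q → T (q ε)} (λ {q} → extend-inflationary q) k
                                  (fromWitness {a? = ε ≟ ε} refl)

    stabilisation : ∃ λ depth → Stable E extend extend-inflationary (stage depth)
    stabilisation = iterate-stabilises E extend extend-inflationary isε

    depth : ℕ
    depth = proj₁ stabilisation

    reached : Carrier → Bool
    reached = stage depth

    reached-resp : (T ∘ reached) Respects _≈_
    reached-resp = stage-resp depth

    reached-closed : ∀ {e} → Extends reached e → T (reached e)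
    reached-closed {e} ext =
      All.lookupₛ setoid stable-resp (proj₂ stabilisation)
                  (E-complete e) (fromWitness {a? = extends? reached e} ext)
      where
      stable-resp : (λ x → T (extend reached x) → T (reached x)) Respects _≈_
      stable-resp a≈b closed ext′ = reached-resp a≈b (closed (extend-resp reached-resp (sym a≈b) ext′))

    RightInvariant : Carrier → Set
    RightInvariant g = ∀ {t} → T (reached t) → T (reached (t ∙ g))

    generator-invariant : ∀ {p} → p ∈ L → RightInvariant p × RightInvariant (p ⁻¹)
    generator-invariant {p} p∈L =
        (λ r → reached-closed (via-p (inj₁ (reached-resp (sym (//-rightDividesʳ p _)) r))))
      , (λ r → reached-closed (via-p (inj₂ (reached-resp (sym (//-rightDividesˡ p _)) r))))
      where
      via-p : ∀ {e} → T (reached (e // p)) ⊎ T (reached (e ∙ p)) → Extends reached e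
      via-p = inj₂ ∘ lose (λ p≈p′ → Sum.map (reached-resp (∙-congˡ (⁻¹-cong p≈p′)))
                                            (reached-resp (∙-congˡ p≈p′))) p∈L

    ⟨⟩-invariant : ∀ {g} → ⟨ L ⟩ g → RightInvariant g × RightInvariant (g ⁻¹)
    ⟨⟩-invariant (gen g∈L) = generator-invariant g∈L
    ⟨⟩-invariant unit =
        (λ r → reached-resp (sym (identityʳ _)) r)
      , (λ r → reached-resp (sym (trans (∙-congˡ ε⁻¹≈ε) (identityʳ _))) r)
    ⟨⟩-invariant (mul {g} {h} a b) with ⟨⟩-invariant a | ⟨⟩-invariant b
    ... | a⁺ , a⁻ | b⁺ , b⁻ =
        (λ {t} r → reached-resp (assoc t g h) (b⁺ (a⁺ r)))
      , (λ {t} r → reached-resp (trans (assoc t (h ⁻¹) (g ⁻¹)) (∙-congˡ (sym (⁻¹-anti-homo-∙ g h))))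
                                (a⁻ (b⁻ r)))
    ⟨⟩-invariant (inv {g} a) with ⟨⟩-invariant a
    ... | a⁺ , a⁻ = a⁻ , (λ r → reached-resp (∙-congˡ (sym (⁻¹-involutive g))) (a⁺ r))
    ⟨⟩-invariant (resp g≈h a) with ⟨⟩-invariant a
    ... | a⁺ , a⁻ = (λ r → reached-resp (∙-congˡ g≈h) (a⁺ r))
                  , (λ r → reached-resp (∙-congˡ (⁻¹-cong g≈h)) (a⁻ r))

    ⟨⟩⇒reached : ∀ {g} → ⟨ L ⟩ g → T (reached g)
    ⟨⟩⇒reached {g} a = reached-resp (identityˡ g) (proj₁ (⟨⟩-invariant a) (stage-ε depth))

  ⟨_⟩? : ∀ L g → Dec (⟨ L ⟩ g)
  ⟨ L ⟩? g = map′ (stage-sound depth) ⟨⟩⇒reached (T? (reached g))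
    where open Reachability L

  Generates? : ∀ L → Dec (Generates L)
  Generates? L = map′ (λ all g → All.lookupₛ setoid resp all (E-complete g))
                      (λ genL → All.tabulate (λ _ → genL _))
                      (All.all? ⟨ L ⟩? E)

  _∈?_ : Decidable _∈_
  g ∈? P = Any.any? (g ≟_) P

  unplayed : List Carrier → ℕ
  unplayed P = count (λ e → ⌊ ¬? (e ∈? P) ⌋) E

  unplayed-decreasing : ∀ {g P} → g ∉ P → unplayed (g ∷ P) < unplayed P
  unplayed-decreasing {g} {P} g∉P = count-mono-< still-unplayed (Any.map newly-played (E-complete g))
    where
    still-unplayed : ∀ {e} → T ⌊ ¬? (e ∈? (g ∷ P)) ⌋ → T ⌊ ¬? (e ∈? P) ⌋
    still-unplayed {e} e∉g∷P =
      fromWitness {a? = ¬? (e ∈? P)} (λ e∈P → toWitness {a? = ¬? (e ∈? (g ∷ P))} e∉g∷P (there e∈P))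
    newly-played : ∀ {e} → g ≈ e → T ⌊ ¬? (e ∈? P) ⌋ × ¬ T ⌊ ¬? (e ∈? (g ∷ P)) ⌋
    newly-played {e} g≈e =
        fromWitness {a? = ¬? (e ∈? P)} (λ e∈P → g∉P (∈-resp-≈ setoid (sym g≈e) e∈P))
      , (λ e∉g∷P → toWitness {a? = ¬? (e ∈? (g ∷ P))} e∉g∷P (here (sym g≈e)))

  _≐_ : List Carrier → List Carrier → Set
  P ≐ Q = P ⊆ Q × Q ⊆ P

  ∷-≐ : ∀ g {P Q} → P ≐ Q → (g ∷ P) ≐ (g ∷ Q)
  ∷-≐ g (P⊆Q , Q⊆P) = ∷⁺ʳ setoid g P⊆Q , ∷⁺ʳ setoid g Q⊆P

  ≈-∷-≐ : ∀ {g h} P → g ≈ h → (g ∷ P) ≐ (h ∷ P)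
  ≈-∷-≐ P g≈h = ∈-∷⁺ʳ setoid (here g≈h) there , ∈-∷⁺ʳ setoid (here (sym g≈h)) there

  NimValue-resp : ∀ {P Q n} → P ≐ Q → NimValue P n → NimValue Q n
  NimValue-resp P≐Q (terminal genP) = terminal (Generates-⊆ (proj₁ P≐Q) genP)
  NimValue-resp {P} {Q} {n} P≐Q (nonterminal ¬genP avoids below) =
    nonterminal (¬genP ∘ Generates-⊆ (proj₂ P≐Q)) avoids′ below′
    where
    avoids′ : ∀ g → g ∉ Q → ∃ λ m → NimValue (g ∷ Q) m × ¬ (m ≡ n)
    avoids′ g g∉Q with avoids g (g∉Q ∘ proj₁ P≐Q)
    ... | m , opt , m≢n = m , NimValue-resp (∷-≐ g P≐Q) opt , m≢n
    below′ : ∀ k → k < n → ∃ λ g → g ∉ Q × NimValue (g ∷ Q) k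
    below′ k k<n with below k k<n
    ... | g , g∉P , opt = g , g∉P ∘ proj₂ P≐Q , NimValue-resp (∷-≐ g P≐Q) opt

  mutual
    NimValue-unique : ∀ {P m n} → NimValue P m → NimValue P n → m ≡ n
    NimValue-unique (terminal _)            (terminal _)            = ≡.refl
    NimValue-unique (terminal genP)         (nonterminal ¬genP _ _) = ⊥-elim (¬genP genP)
    NimValue-unique (nonterminal ¬genP _ _) (terminal genP)         = ⊥-elim (¬genP genP)
    NimValue-unique {m = m} {n} (nonterminal _ avoids₁ below₁) (nonterminal _ avoids₂ below₂)
      with <-cmp m n
    ... | tri< m<n _ _ = ⊥-elim (avoided⇒unattained avoids₁ (below₂ m m<n))
    ... | tri≈ _ m≡n _ = m≡n
    ... | tri> _ _ n<m = ⊥-elim (avoided⇒unattained avoids₂ (below₁ n n<m))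

    avoided⇒unattained : ∀ {P k} → (∀ g → g ∉ P → ∃ λ m → NimValue (g ∷ P) m × ¬ (m ≡ k))
                       → ¬ (∃ λ g → g ∉ P × NimValue (g ∷ P) k)
    avoided⇒unattained avoids (g , g∉P , opt) with avoids g g∉P
    ... | m , opt′ , m≢k = m≢k (NimValue-unique opt′ opt)

  nonterminal-value : ∀ {P} → ¬ Generates P → (∀ g → g ∉ P → ∃ (NimValue (g ∷ P)))
                    → ∃ (NimValue P)
  nonterminal-value {P} ¬genP option-value = n , nonterminal ¬genP avoids below
    where
    values : List Carrier → List ℕ
    values []       = []
    values (e ∷ es) with e ∈? P
    ... | yes _   = values es
    ... | no e∉P = proj₁ (option-value e e∉P) ∷ values es

    n : ℕ
    n = proj₁ (mex (values E))

    values-complete : ∀ {g} es → g ∈ es → g ∉ P → ∃ λ m → NimValue (g ∷ P) m × m ∈ₚ values es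
    values-complete (e ∷ es) g∈e∷es g∉P with e ∈? P | g∈e∷es
    ... | yes e∈P | here g≈e   = ⊥-elim (g∉P (∈-resp-≈ setoid (sym g≈e) e∈P))
    ... | yes _   | there g∈es = values-complete es g∈es g∉P
    ... | no e∉P  | here g≈e   =
        proj₁ (option-value e e∉P)
      , NimValue-resp (≈-∷-≐ P (sym g≈e)) (proj₂ (option-value e e∉P))
      , here ≡.refl
    ... | no _    | there g∈es with values-complete es g∈es g∉P
    ...   | m , opt , m∈ = m , opt , there m∈

    values-sound : ∀ es {k} → k ∈ₚ values es → ∃ λ g → g ∉ P × NimValue (g ∷ P) k
    values-sound (e ∷ es) k∈ with e ∈? P
    ... | yes _ = values-sound es k∈
    ... | no e∉P with k∈
    ...   | here ≡.refl = e , e∉P , proj₂ (option-value e e∉P)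
    ...   | there k∈′   = values-sound es k∈′

    avoids : ∀ g → g ∉ P → ∃ λ m → NimValue (g ∷ P) m × ¬ (m ≡ n)
    avoids g g∉P with values-complete E (E-complete g) g∉P
    ... | m , opt , m∈ = m , opt , λ { ≡.refl → proj₁ (proj₂ (mex (values E))) m∈ }

    below : ∀ k → k < n → ∃ λ g → g ∉ P × NimValue (g ∷ P) k
    below k k<n = values-sound E (proj₂ (proj₂ (mex (values E))) k<n)

  NimValue-exists : ∀ P → ∃ (NimValue P)
  NimValue-exists P = go P (<-wellFounded (unplayed P))
    where
    go : ∀ P → Acc _<_ (unplayed P) → ∃ (NimValue P)
    go P (acc smaller) with Generates? P
    ... | yes genP  = 0 , terminal genP
    ... | no ¬genP = nonterminal-value ¬genP (λ g g∉P → go (g ∷ P) (smaller (unplayed-decreasing g∉P)))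

  AnsweredByZero : List Carrier → Carrier → Set
  AnsweredByZero P g = ¬ Generates (g ∷ P) × ∃ λ h → h ∉ g ∷ P × NimValue (h ∷ g ∷ P) 0

  NimValue-zero : ∀ {P} → ¬ Generates P → (∀ g → g ∉ P → AnsweredByZero P g) → NimValue P 0
  NimValue-zero {P} ¬genP answer = nonterminal ¬genP avoids (λ _ ())
    where
    avoids : ∀ g → g ∉ P → ∃ λ m → NimValue (g ∷ P) m × ¬ (m ≡ 0)
    avoids g g∉P with NimValue-exists (g ∷ P) | answer g g∉P
    ... | m , opt | ¬genQ , h , h∉Q , zero-answer = m , opt , λ { ≡.refl → not-zero opt }
      where
      not-zero : ¬ NimValue (g ∷ P) 0
      not-zero (terminal genQ)          = ¬genQ genQ
      not-zero (nonterminal _ avoids′ _) = avoided⇒unattained avoids′ (h , h∉Q , zero-answer)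

  NoGeneratingMove : List Carrier → Set
  NoGeneratingMove P = ∀ h → ¬ Generates (h ∷ P)

  generating-move? : ∀ P → (∃ λ h → Generates (h ∷ P)) ⊎ NoGeneratingMove P
  generating-move? P with Any.any? (λ e → Generates? (e ∷ P)) E
  ... | yes some = inj₁ (Any.satisfied some)
  ... | no none  = inj₂ λ h gen-h →
    none (lose (λ a≈b → Generates-⊆ (proj₁ (≈-∷-≐ P a≈b))) (E-complete h) gen-h)

  generating-move-∉ : ∀ {P h} → ¬ Generates P → Generates (h ∷ P) → h ∉ P
  generating-move-∉ ¬genP gen-h h∈P = ¬genP (Generates-⊆ (∈-∷⁺ʳ setoid h∈P (λ y∈ → y∈)) gen-h)

module DihedralGame (A : AbelianGroup 0ℓ 0ℓ) (A-finite : IsFinite A) where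
  private
    module A = AbelianGroup A
    module GA = GroupNotions A.group
    module AP = GroupProperties A.group
  open IsFinite A-finite renaming (_≟_ to _≟A_)
  open Group (Dih A)
  open GroupProperties (Dih A) using (//-rightDividesʳ)
  open GroupNotions (Dih A)
  open SetoidMembership setoid using (_∈_; _∉_; lose)
  open SetoidMembershipProperties using (∈-resp-≈; ∈-++⁺ˡ; ∈-++⁺ʳ; ∈-map⁺)
  open SetoidSubsetProperties using (∈-∷⁺ʳ)

  elementsD : List Carrier
  elementsD = map (false ,_) elements ++ map (true ,_) elements

  elementsD-complete : ∀ g → g ∈ elementsD
  elementsD-complete (false , a) =
    ∈-++⁺ˡ setoid (∈-map⁺ A.setoid setoid (≡.refl ,_) (complete a))
  elementsD-complete (true , a) =
    ∈-++⁺ʳ setoid (map (false ,_) elements) (∈-map⁺ A.setoid setoid (≡.refl ,_) (complete a))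

  _≟D_ : Decidable _≈_
  _≟D_ = ×-decidable Bool._≟_ _≟A_

  open FiniteGroup (Dih A) elementsD elementsD-complete _≟D_ public

  x : Carrier
  x = (true , A.ε)

  mirror : Carrier → Carrier
  mirror (s , a) = (not s , a)

  mirror≈x∙ : ∀ g → mirror g ≈ x ∙ g
  mirror≈x∙ (false , a) = ≡.refl , A.sym (A.identityˡ a)
  mirror≈x∙ (true  , a) = ≡.refl , A.sym (A.trans (A.∙-congʳ AP.ε⁻¹≈ε) (A.identityˡ a))

  mirror-cong : ∀ {g h} → g ≈ h → mirror g ≈ mirror h
  mirror-cong (≡.refl , a≈b) = ≡.refl , a≈b

  mirror-involutive : ∀ g → mirror (mirror g) ≈ g
  mirror-involutive (s , a) = Bool.not-involutive s , A.refl

  mirror-≉ : ∀ g → ¬ (mirror g ≈ g)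
  mirror-≉ (false , _) (() , _)
  mirror-≉ (true  , _) (() , _)

  x∈⟨⟩ : ∀ {L p} → ⟨ L ⟩ p → ⟨ L ⟩ (mirror p) → ⟨ L ⟩ x
  x∈⟨⟩ {p = p} p∈ mirror-p∈ =
    resp (trans (∙-congʳ (mirror≈x∙ p)) (//-rightDividesʳ p x)) (mul mirror-p∈ (inv p∈))

  mirror∈⟨⟩ : ∀ {L g} → ⟨ L ⟩ x → ⟨ L ⟩ g → ⟨ L ⟩ (mirror g)
  mirror∈⟨⟩ {g = g} x∈ g∈ = resp (sym (mirror≈x∙ g)) (mul x∈ g∈)

  -- x acts on A-coordinates by inversion, so they never leave the subgroup generated by a and b.
  A-coordinate∈⟨⟩ : ∀ {s a t b c} → ⟨ (t , b) ∷ mirror (s , a) ∷ (s , a) ∷ [] ⟩ c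
                  → GA.⟨ a ∷ b ∷ [] ⟩ (proj₂ c)
  A-coordinate∈⟨⟩ (gen (here (_ , c≈b)))                 = GA.gen (there (here c≈b))
  A-coordinate∈⟨⟩ (gen (there (here (_ , c≈a))))         = GA.gen (here c≈a)
  A-coordinate∈⟨⟩ (gen (there (there (here (_ , c≈a))))) = GA.gen (here c≈a)
  A-coordinate∈⟨⟩ unit                                    = GA.unit
  A-coordinate∈⟨⟩ (mul {_ , _} {false , _} c d)          = GA.mul (A-coordinate∈⟨⟩ c) (A-coordinate∈⟨⟩ d)
  A-coordinate∈⟨⟩ (mul {_ , _} {true  , _} c d)          = GA.mul (GA.inv (A-coordinate∈⟨⟩ c)) (A-coordinate∈⟨⟩ d)
  A-coordinate∈⟨⟩ (inv {false , _} c)                    = GA.inv (A-coordinate∈⟨⟩ c)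
  A-coordinate∈⟨⟩ (inv {true  , _} c)                    = A-coordinate∈⟨⟩ c
  A-coordinate∈⟨⟩ (resp (_ , c≈d) c∈)                    = GA.resp c≈d (A-coordinate∈⟨⟩ c∈)

  no-generating-triple : d≥ A 3 → ∀ g h → ¬ Generates (h ∷ mirror g ∷ g ∷ [])
  no-generating-triple d≥3 (s , a) (t , b) genD =
    d≥3 (a ∷ b ∷ []) (s≤s (s≤s (s≤s z≤n))) (λ c → A-coordinate∈⟨⟩ (genD (false , c)))

  MirrorClosed : List Carrier → Set
  MirrorClosed P = ∀ {q} → q ∈ P → mirror q ∈ P

  record Balanced (P : List Carrier) : Set where
    field
      mirror-closed      : MirrorClosed P
      nonempty           : ∃ (_∈ P)
      no-generating-move : NoGeneratingMove P

  mirror-move-∉ : ∀ {P g} → MirrorClosed P → g ∉ P → mirror g ∉ g ∷ P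
  mirror-move-∉ {g = g} closed g∉P (here mirror-g≈g) = mirror-≉ g mirror-g≈g
  mirror-move-∉ {g = g} closed g∉P (there mirror-g∈P) =
    g∉P (∈-resp-≈ setoid (mirror-involutive g) (closed mirror-g∈P))

  mirror-move-closed : ∀ {P} g → MirrorClosed P → MirrorClosed (mirror g ∷ g ∷ P)
  mirror-move-closed g closed (here q≈mirror-g)   =
    there (here (trans (mirror-cong q≈mirror-g) (mirror-involutive g)))
  mirror-move-closed g closed (there (here q≈g))  = here (mirror-cong q≈g)
  mirror-move-closed g closed (there (there q∈P)) = there (there (closed q∈P))

  mirror-move-balanced : ∀ {P g} → Balanced P → NoGeneratingMove (g ∷ P) → Balanced (mirror g ∷ g ∷ P)
  mirror-move-balanced {P} {g} balanced no-move = record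
    { mirror-closed      = mirror-move-closed g mirror-closed
    ; nonempty           = g , there (here refl)
    ; no-generating-move = λ h → no-move h ∘ Generates-mono (h∷mirror-g∷g∷P⊆⟨h∷g∷P⟩ h)
    }
    where
    open Balanced balanced
    h∷mirror-g∷g∷P⊆⟨h∷g∷P⟩ : ∀ h {y} → y ∈ h ∷ mirror g ∷ g ∷ P → ⟨ h ∷ g ∷ P ⟩ y
    h∷mirror-g∷g∷P⊆⟨h∷g∷P⟩ h (here y≈h)                = gen (here y≈h)
    h∷mirror-g∷g∷P⊆⟨h∷g∷P⟩ h (there (here y≈mirror-g)) =
      resp (sym y≈mirror-g) (mirror∈⟨⟩ x∈ (gen (there (here refl))))
      where
      x∈ : ⟨ h ∷ g ∷ P ⟩ x
      x∈ with nonempty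
      ... | p , p∈P = x∈⟨⟩ (gen (there (there p∈P))) (gen (there (there (mirror-closed p∈P))))
    h∷mirror-g∷g∷P⊆⟨h∷g∷P⟩ h (there (there y∈g∷P))    = gen (there y∈g∷P)

  mirror-pair-balanced : d≥ A 3 → ∀ g → Balanced (mirror g ∷ g ∷ [])
  mirror-pair-balanced d≥3 g = record
    { mirror-closed      = mirror-move-closed g (λ ())
    ; nonempty           = g , there (here refl)
    ; no-generating-move = no-generating-triple d≥3 g
    }

  balanced-zero : ∀ {P} → Balanced P → NimValue P 0
  balanced-zero {P} balanced = go P (<-wellFounded (unplayed P)) balanced
    where
    go : ∀ P → Acc _<_ (unplayed P) → Balanced P → NimValue P 0
    go P (acc smaller) balanced = NimValue-zero (no-generating-move x ∘ Generates-⊆ there) answer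
      where
      open Balanced balanced
      answer : ∀ g → g ∉ P → AnsweredByZero P g
      answer g g∉P with generating-move? (g ∷ P)
      ... | inj₁ (h , gen-h) =
        no-generating-move g , h , generating-move-∉ (no-generating-move g) gen-h , terminal gen-h
      ... | inj₂ no-move =
          no-generating-move g , mirror g , mirror-move-∉ mirror-closed g∉P
        , go (mirror g ∷ g ∷ P)
             (smaller (<-trans (unplayed-decreasing (mirror-move-∉ mirror-closed g∉P))
                               (unplayed-decreasing g∉P)))
             (mirror-move-balanced balanced no-move)

proposition5p2 : (A : AbelianGroup 0ℓ 0ℓ) → IsFinite A → d≥ A 3
    → GroupNotions.GEN≡* (Dih A) 0
proposition5p2 A A-finite d≥3 = NimValue-zero ¬gen[] answer
  where
  open DihedralGame A A-finite
  open GroupNotions (Dih A)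
  open SetoidMembership (Group.setoid (Dih A)) using (_∉_)

  ¬gen[] : ¬ Generates []
  ¬gen[] = no-generating-triple d≥3 x x ∘ Generates-⊆ (λ ())

  answer : ∀ g → g ∉ [] → AnsweredByZero [] g
  answer g _ = no-generating-triple d≥3 g g ∘ Generates-⊆ (there ∘ there)
             , mirror g , mirror-move-∉ (λ ()) (λ ())
             , balanced-zero (mirror-pair-balanced d≥3 g)
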